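{- Let $r_1,\dots,r_n\ge 0$ and $w_1,\dots,w_n>0$ be such that $r_i/w_i$, $i=1,\dots,n$, is a non-increasing sequence, and let $w=\sum_{i=1}^n w_i$. Then for every $k\in\{1,\dots,n+1\}$, \[\sum_{i<k} r_i\Big(1-\frac{1}{w}\sum_{j<i} w_j\Big) \;\ge\; \frac{\big(\sum_{i<k} r_i\big)\big(\sum_{i<k} w_i\big)}{2w} + \sum_{i<k}\frac{r_i w_i}{2w} + \sum_{i<k} r_i\,\frac{\sum_{j\ge k} w_j}{w}.\]
   Formalization: The numbers $r_1,\dots,r_n$ and $w_1,\dots,w_n$ are rational. -}

module Defs where

open import Data.Bool using (Bool; if_then_else_)
open import Data.Nat using (ℕ; zero; suc)
open import Data.Fin using (Fin; zero; suc)
open import Data.Rational using (ℚ; 0ℚ; _+_; _÷_; Positive)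
open import Data.Rational.Properties using (pos⇒nonZero)

∑ : ∀ {n} → (Fin n → ℚ) → ℚ
∑ {zero}  f = 0ℚ
∑ {suc n} f = f zero + ∑ (λ i → f (suc i))

∑If : ∀ {n} → (Fin n → Bool) → (Fin n → ℚ) → ℚ
∑If P f = ∑ (λ i → if P i then f i else 0ℚ)

_÷⁺_ : (p q : ℚ) → Positive q → ℚ
(p ÷⁺ q) pos = (p ÷ q) {{pos⇒nonZero q {{pos}}}}

module Submission where

-- Write the prefix sums R = ∑_{i<m} r_i, V = ∑_{i<m} w_i,
-- A = ∑_{i<m} r_i (∑_{j<i} w_j) and Q = ∑_{i<m} r_i w_i, where k = m + 1.
-- Expanding R·V over pairs of indices gives
--     R·V − (2A + Q) = ∑_{i<j<m} (r_i w_j − r_j w_i),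
-- and every summand is non-negative because r/w is non-increasing.  We prove
-- this "prefix gap" inequality 2A + Q ≤ R·V by induction on n, splitting off
-- the first index: the new terms are controlled by w_0 · ∑ r_{i+1} ≤
-- r_0 · ∑ w_{i+1}.  The theorem is then this inequality divided by 2W, after
-- using W = (∑_{i≥m} w_i) + V to rewrite R = R·(∑_{i≥m} w_i + V)/W.

open import Defs
open import Data.Nat using (ℕ; suc; _<ᵇ_)
open import Data.Fin using (Fin; toℕ)
open import Data.Rational using (ℚ; 0ℚ; 1ℚ; ½; _+_; _-_; _*_; _≤_; _≥_; Positive)
open import Data.Bool using (Bool; not)
import Data.Fin as F
import Data.Nat as N

open import Data.Bool using (true; false; if_then_else_)
open import Data.Rational using (-_; 1/_; _÷_; NonZero; NonNegative; nonNegative)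
open import Data.Rational.Properties
open import Data.Rational.Solver using (module +-*-Solver)
open import Relation.Binary.PropositionalEquality
open +-*-Solver using (solve; _:+_; _:*_; _:-_; :-_; _:=_; con)

∑-cong : ∀ {n} {f g : Fin n → ℚ} → (∀ i → f i ≡ g i) → ∑ f ≡ ∑ g
∑-cong {N.zero}  f≡g = refl
∑-cong {suc n}   f≡g = cong₂ _+_ (f≡g F.zero) (∑-cong (λ i → f≡g (F.suc i)))

∑-zero : ∀ n → ∑ {n} (λ _ → 0ℚ) ≡ 0ℚ
∑-zero N.zero    = refl
∑-zero (suc n)   = trans (cong (0ℚ +_) (∑-zero n)) (+-identityˡ 0ℚ)

∑-+ : ∀ {n} (f g : Fin n → ℚ) → ∑ (λ i → f i + g i) ≡ ∑ f + ∑ g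
∑-+ {N.zero}  f g = refl
∑-+ {suc n}   f g = begin
  (f₀ + g₀) + ∑ (λ i → f (F.suc i) + g (F.suc i))
    ≡⟨ cong ((f₀ + g₀) +_) (∑-+ (λ i → f (F.suc i)) (λ i → g (F.suc i))) ⟩
  (f₀ + g₀) + (∑ (λ i → f (F.suc i)) + ∑ (λ i → g (F.suc i)))
    ≡⟨ solve 4 (λ a b c d → (a :+ b) :+ (c :+ d) := (a :+ c) :+ (b :+ d)) refl
         f₀ g₀ (∑ (λ i → f (F.suc i))) (∑ (λ i → g (F.suc i))) ⟩
  (f₀ + ∑ (λ i → f (F.suc i))) + (g₀ + ∑ (λ i → g (F.suc i))) ∎
  where
  open ≡-Reasoning
  f₀ g₀ : ℚ
  f₀ = f F.zero
  g₀ = g F.zero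

∑-scale : ∀ {n} (a : ℚ) (f : Fin n → ℚ) → ∑ (λ i → a * f i) ≡ a * ∑ f
∑-scale {N.zero}  a f = sym (*-zeroʳ a)
∑-scale {suc n}   a f = trans (cong (a * f F.zero +_) (∑-scale a (λ i → f (F.suc i))))
                              (sym (*-distribˡ-+ a _ _))

∑-mono : ∀ {n} {f g : Fin n → ℚ} → (∀ i → f i ≤ g i) → ∑ f ≤ ∑ g
∑-mono {N.zero}  f≤g = ≤-refl
∑-mono {suc n}   f≤g = +-mono-≤ (f≤g F.zero) (∑-mono (λ i → f≤g (F.suc i)))

∑If-+ : ∀ {n} (P : Fin n → Bool) (f g : Fin n → ℚ)
      → ∑If P (λ i → f i + g i) ≡ ∑If P f + ∑If P g
∑If-+ P f g = trans (∑-cong filter-+) (∑-+ (λ i → if P i then f i else 0ℚ) (λ i → if P i then g i else 0ℚ))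
  where
  filter-+ : ∀ i → (if P i then f i + g i else 0ℚ)
                   ≡ (if P i then f i else 0ℚ) + (if P i then g i else 0ℚ)
  filter-+ i with P i
  ... | true  = refl
  ... | false = sym (+-identityˡ 0ℚ)

∑If-scale : ∀ {n} (P : Fin n → Bool) (a : ℚ) (f h : Fin n → ℚ)
          → (∀ i → h i ≡ a * f i) → ∑If P h ≡ a * ∑If P f
∑If-scale P a f h h≡af = trans (∑-cong filter-scale) (∑-scale a (λ i → if P i then f i else 0ℚ))
  where
  filter-scale : ∀ i → (if P i then h i else 0ℚ) ≡ a * (if P i then f i else 0ℚ)
  filter-scale i with P i
  ... | true  = h≡af i
  ... | false = sym (*-zeroʳ a)

∑If-lin : ∀ {n} (P : Fin n → Bool) (a b : ℚ) (f g h : Fin n → ℚ)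
        → (∀ i → h i ≡ a * f i + b * g i)
        → ∑If P h ≡ a * ∑If P f + b * ∑If P g
∑If-lin P a b f g h h≡af+bg = begin
  ∑If P h                                    ≡⟨ ∑-cong filter-h ⟩
  ∑If P (λ i → a * f i + b * g i)            ≡⟨ ∑If-+ P _ _ ⟩
  ∑If P (λ i → a * f i) + ∑If P (λ i → b * g i)
    ≡⟨ cong₂ _+_ (∑If-scale P a f _ (λ _ → refl)) (∑If-scale P b g _ (λ _ → refl)) ⟩
  a * ∑If P f + b * ∑If P g                  ∎
  where
  open ≡-Reasoning
  filter-h : ∀ i → (if P i then h i else 0ℚ) ≡ (if P i then a * f i + b * g i else 0ℚ)
  filter-h i = cong (λ x → if P i then x else 0ℚ) (h≡af+bg i)

∑If-mono : ∀ {n} (P : Fin n → Bool) {f g : Fin n → ℚ}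
         → (∀ i → f i ≤ g i) → ∑If P f ≤ ∑If P g
∑If-mono P {f} {g} f≤g = ∑-mono filter-mono
  where
  filter-mono : ∀ i → (if P i then f i else 0ℚ) ≤ (if P i then g i else 0ℚ)
  filter-mono i with P i
  ... | true  = f≤g i
  ... | false = ≤-refl

∑If-split : ∀ {n} (P : Fin n → Bool) (f : Fin n → ℚ)
          → ∑If (λ i → not (P i)) f + ∑If P f ≡ ∑ f
∑If-split P f = trans (sym (∑-+ (λ i → if not (P i) then f i else 0ℚ) (λ i → if P i then f i else 0ℚ)))
                      (∑-cong complement)
  where
  complement : ∀ i → (if not (P i) then f i else 0ℚ) + (if P i then f i else 0ℚ) ≡ f i
  complement i with P i
  ... | true  = +-identityˡ (f i)
  ... | false = +-identityʳ (f i)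

prefix : ∀ {n} → ℕ → Fin n → Bool
prefix m i = toℕ i <ᵇ m

partial : ∀ {n} → (Fin n → ℚ) → Fin n → ℚ
partial w i = ∑If (prefix (toℕ i)) w

-- Splitting off the first index in a weighted prefix sum ∑_{i≤m} r_i ∑_{j<i} w_j:
-- the term i = 0 vanishes and each later partial sum contains w_0.
weighted-prefix-step : ∀ {n} (r w : Fin (suc n) → ℚ) (m : ℕ)
  → ∑If (prefix (suc m)) (λ i → r i * partial w i)
    ≡ w F.zero * ∑If (prefix m) (λ i → r (F.suc i))
      + ∑If (prefix m) (λ i → r (F.suc i) * partial (λ j → w (F.suc j)) i)
weighted-prefix-step {n} r w m = begin
  r F.zero * (0ℚ + ∑ {n} (λ _ → 0ℚ)) + ∑If (prefix m) tail-body
    ≡⟨ cong (_+ ∑If (prefix m) tail-body) first-term-vanishes ⟩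
  0ℚ + ∑If (prefix m) tail-body
    ≡⟨ +-identityˡ _ ⟩
  ∑If (prefix m) tail-body
    ≡⟨ ∑If-lin (prefix m) (w F.zero) 1ℚ _ _ tail-body distribute ⟩
  w F.zero * ∑If (prefix m) (λ i → r (F.suc i))
    + 1ℚ * ∑If (prefix m) (λ i → r (F.suc i) * partial (λ j → w (F.suc j)) i)
    ≡⟨ cong (w F.zero * ∑If (prefix m) (λ i → r (F.suc i)) +_) (*-identityˡ _) ⟩
  w F.zero * ∑If (prefix m) (λ i → r (F.suc i))
    + ∑If (prefix m) (λ i → r (F.suc i) * partial (λ j → w (F.suc j)) i) ∎
  where
  open ≡-Reasoning
  tail-body : Fin n → ℚ
  tail-body i = r (F.suc i) * (w F.zero + partial (λ j → w (F.suc j)) i)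
  first-term-vanishes : r F.zero * (0ℚ + ∑ {n} (λ _ → 0ℚ)) ≡ 0ℚ
  first-term-vanishes = trans (cong (λ s → r F.zero * (0ℚ + s)) (∑-zero n)) (*-zeroʳ (r F.zero))
  distribute : ∀ i → tail-body i
                     ≡ w F.zero * r (F.suc i) + 1ℚ * (r (F.suc i) * partial (λ j → w (F.suc j)) i)
  distribute i = solve 3 (λ a b c → a :* (b :+ c) := b :* a :+ con 1ℚ :* (a :* c)) refl
                   (r (F.suc i)) (w F.zero) (partial (λ j → w (F.suc j)) i)

÷-cancel : ∀ (p x y : ℚ) .{{_ : NonZero y}} → (p ÷ y) * (x * y) ≡ p * x
÷-cancel p x y = begin
  p * 1/ y * (x * y)   ≡⟨ solve 4 (λ p x y v → p :* v :* (x :* y) := (p :* x) :* (y :* v)) refl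
                            p x y (1/ y) ⟩
  p * x * (y * 1/ y)   ≡⟨ cong (p * x *_) (*-inverseʳ y) ⟩
  p * x * 1ℚ           ≡⟨ *-identityʳ (p * x) ⟩
  p * x                ∎
  where open ≡-Reasoning

÷-cross : ∀ {p q x y : ℚ} (x-pos : Positive x) (y-pos : Positive y)
        → (p ÷⁺ y) y-pos ≤ (q ÷⁺ x) x-pos → x * p ≤ q * y
÷-cross {p} {q} {x} {y} x-pos y-pos p/y≤q/x = subst₂ _≤_ lhs rhs scaled
  where
  instance
    x≢0 : NonZero x
    x≢0 = pos⇒nonZero x {{x-pos}}
    y≢0 : NonZero y
    y≢0 = pos⇒nonZero y {{y-pos}}
    xy≥0 : NonNegative (x * y)
    xy≥0 = nonNeg*nonNeg⇒nonNeg x {{pos⇒nonNeg x {{x-pos}}}} y {{pos⇒nonNeg y {{y-pos}}}}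
  scaled : (p ÷ y) * (x * y) ≤ (q ÷ x) * (x * y)
  scaled = *-monoʳ-≤-nonNeg (x * y) p/y≤q/x
  lhs : (p ÷ y) * (x * y) ≡ x * p
  lhs = trans (÷-cancel p x y) (*-comm p x)
  rhs : (q ÷ x) * (x * y) ≡ q * y
  rhs = trans (cong ((q ÷ x) *_) (*-comm x y)) (÷-cancel q y x)

-- The ratio r/w is non-increasing, stated without division:
-- for i ≤ j we have r_j w_i ≤ r_i w_j.
CrossOrdered : ∀ {n} → (r w : Fin n → ℚ) → Set
CrossOrdered r w = ∀ i j → i F.≤ j → w i * r j ≤ r i * w j

head-dominates : ∀ {n} (r w : Fin (suc n) → ℚ) → CrossOrdered r w
  → (P : Fin n → Bool)
  → w F.zero * ∑If P (λ i → r (F.suc i)) ≤ r F.zero * ∑If P (λ i → w (F.suc i))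
head-dominates r w ordered P = subst₂ _≤_
  (∑If-scale P (w F.zero) _ _ (λ _ → refl))
  (∑If-scale P (r F.zero) _ _ (λ _ → refl))
  (∑If-mono P (λ i → ordered F.zero (F.suc i) N.z≤n))

prefix-gap : ∀ {n} (r w : Fin n → ℚ) → CrossOrdered r w → (m : ℕ)
  → let A = ∑If (prefix m) (λ i → r i * partial w i)
    in A + A + ∑If (prefix m) (λ i → r i * w i) ≤ ∑If (prefix m) r * ∑If (prefix m) w
prefix-gap {N.zero} r w ordered m = ≤-refl
prefix-gap {suc n} r w ordered N.zero =
  subst (λ z → z + z + z ≤ z * z) (sym (∑-zero (suc n))) ≤-refl
prefix-gap {suc n} r w ordered (suc m) = begin
  A + A + (r₀ * w₀ + Q′)
    ≡⟨ cong (λ a → a + a + (r₀ * w₀ + Q′)) (weighted-prefix-step r w m) ⟩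
  (w₀ * R′ + A′) + (w₀ * R′ + A′) + (r₀ * w₀ + Q′)
    ≡⟨ solve 5 (λ r₀ w₀ R′ A′ Q′ →
         (w₀ :* R′ :+ A′) :+ (w₀ :* R′ :+ A′) :+ (r₀ :* w₀ :+ Q′)
         := (A′ :+ A′ :+ Q′) :+ (w₀ :* R′ :+ (w₀ :* R′ :+ r₀ :* w₀))) refl r₀ w₀ R′ A′ Q′ ⟩
  (A′ + A′ + Q′) + (w₀ * R′ + (w₀ * R′ + r₀ * w₀))
    ≤⟨ +-mono-≤ (prefix-gap r′ w′ ordered′ m)
                (+-monoˡ-≤ (w₀ * R′ + r₀ * w₀) (head-dominates r w ordered (prefix m))) ⟩
  R′ * W′ + (r₀ * W′ + (w₀ * R′ + r₀ * w₀))
    ≡⟨ solve 4 (λ r₀ w₀ R′ W′ →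
         R′ :* W′ :+ (r₀ :* W′ :+ (w₀ :* R′ :+ r₀ :* w₀)) := (r₀ :+ R′) :* (w₀ :+ W′))
         refl r₀ w₀ R′ W′ ⟩
  (r₀ + R′) * (w₀ + W′) ∎
  where
  open ≤-Reasoning
  r₀ w₀ : ℚ
  r₀ = r F.zero
  w₀ = w F.zero
  r′ w′ : Fin n → ℚ
  r′ i = r (F.suc i)
  w′ i = w (F.suc i)
  ordered′ : CrossOrdered r′ w′
  ordered′ i j i≤j = ordered (F.suc i) (F.suc j) (N.s≤s i≤j)
  A A′ Q′ R′ W′ : ℚ
  A = ∑If (prefix (suc m)) (λ i → r i * partial w i)
  A′ = ∑If (prefix m) (λ i → r′ i * partial w′ i)
  Q′ = ∑If (prefix m) (λ i → r′ i * w′ i)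
  R′ = ∑If (prefix m) r′
  W′ = ∑If (prefix m) w′

-- Dividing the prefix gap inequality A + A + Q ≤ R·V by 2W, where
-- u = 1/W and W = U + V, gives the shape of the theorem.
rearrange : ∀ {u R A Q U V : ℚ} → 0ℚ ≤ u → u * (U + V) ≡ 1ℚ → A + A + Q ≤ R * V
          → R * V * u * ½ + u * ½ * Q + U * u * R ≤ 1ℚ * R + (- u) * A
rearrange {u} {R} {A} {Q} {U} {V} u≥0 u[U+V]≡1 gap = begin
  R * V * u * ½ + u * ½ * Q + U * u * R
    ≡⟨ solve 6 (λ u R A Q U V →
         R :* V :* u :* con ½ :+ u :* con ½ :* Q :+ U :* u :* R
         := R :* (u :* (U :+ V)) :+ (:- u) :* A :- u :* con ½ :* (R :* V)
            :+ u :* con ½ :* (A :+ A :+ Q)) refl u R A Q U V ⟩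
  R * (u * (U + V)) + (- u) * A - u * ½ * (R * V) + u * ½ * (A + A + Q)
    ≡⟨ cong (λ t → R * t + (- u) * A - u * ½ * (R * V) + u * ½ * (A + A + Q)) u[U+V]≡1 ⟩
  R * 1ℚ + (- u) * A - u * ½ * (R * V) + u * ½ * (A + A + Q)
    ≤⟨ +-monoʳ-≤ (R * 1ℚ + (- u) * A - u * ½ * (R * V)) (*-monoˡ-≤-nonNeg (u * ½) {{u½≥0}} gap) ⟩
  R * 1ℚ + (- u) * A - u * ½ * (R * V) + u * ½ * (R * V)
    ≡⟨ solve 4 (λ u R A X → R :* con 1ℚ :+ (:- u) :* A :- X :+ X := con 1ℚ :* R :+ (:- u) :* A)
         refl u R A (u * ½ * (R * V)) ⟩
  1ℚ * R + (- u) * A ∎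
  where
  open ≤-Reasoning
  u½≥0 : NonNegative (u * ½)
  u½≥0 = nonNeg*nonNeg⇒nonNeg u {{nonNegative u≥0}} ½

-- The theorem, for k = m + 1: the three sums on the right are rewritten as
-- multiples of R = ∑_{i<m} r_i and Q = ∑_{i<m} r_i w_i, the left side as
-- R − A/W, and the prefix gap inequality finishes via rearrange.
lemma1 : (n : ℕ) (r w : Fin n → ℚ)
           → (∀ i → 0ℚ ≤ r i)
           → (w-pos : ∀ i → Positive (w i))
           → (∀ i j → i F.≤ j → (r j ÷⁺ w j) (w-pos j) ≤ (r i ÷⁺ w i) (w-pos i))
           → (W-pos : Positive (∑ w))
           → (k : ℕ) → 1 N.≤ k → k N.≤ suc n
           → let W = ∑ w
                 below : Fin n → Bool
                 below i = suc (toℕ i) <ᵇ k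
                 above : Fin n → Bool
                 above i = not (suc (toℕ i) <ᵇ k)
             in ∑If below (λ i → r i * (1ℚ - (∑If (λ j → toℕ j <ᵇ toℕ i) w ÷⁺ W) W-pos))
                ≥ ((∑If below r * ∑If below w) ÷⁺ W) W-pos * ½
                  + ∑If below (λ i → ((r i * w i) ÷⁺ W) W-pos * ½)
                  + ∑If below (λ i → r i * (∑If above w ÷⁺ W) W-pos)
lemma1 n r w _ w-pos ratio W-pos (suc m) _ _ = begin
  R * V * u * ½ + ∑If (prefix m) (λ i → r i * w i * u * ½) + ∑If (prefix m) (λ i → r i * (U * u))
    ≡⟨ cong₂ (λ x y → R * V * u * ½ + x + y)
         (∑If-scale (prefix m) (u * ½) _ _ (λ i → factor-out (r i * w i)))
         (∑If-scale (prefix m) (U * u) _ _ (λ i → *-comm (r i) (U * u))) ⟩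
  R * V * u * ½ + u * ½ * Q + U * u * R
    ≤⟨ rearrange {u} {R} {A} {Q} {U} {V} u≥0 u[U+V]≡1 (prefix-gap r w ordered m) ⟩
  1ℚ * R + (- u) * A
    ≡⟨ sym (∑If-lin (prefix m) 1ℚ (- u) r _ _ (λ i → expand (r i) (partial w i))) ⟩
  ∑If (prefix m) (λ i → r i * (1ℚ - partial w i * u)) ∎
  where
  open ≤-Reasoning
  instance
    W≢0 : NonZero (∑ w)
    W≢0 = pos⇒nonZero (∑ w) {{W-pos}}
  u R V U A Q : ℚ
  u = 1/ (∑ w)
  R = ∑If (prefix m) r
  V = ∑If (prefix m) w
  U = ∑If (λ i → not (prefix m i)) w
  A = ∑If (prefix m) (λ i → r i * partial w i)
  Q = ∑If (prefix m) (λ i → r i * w i)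
  u≥0 : 0ℚ ≤ u
  u≥0 = nonNegative⁻¹ u {{pos⇒nonNeg u {{1/pos⇒pos (∑ w) {{W-pos}}}}}}
  u[U+V]≡1 : u * (U + V) ≡ 1ℚ
  u[U+V]≡1 = trans (cong (u *_) (∑If-split (prefix m) w)) (*-inverseˡ (∑ w))
  expand : ∀ a s → a * (1ℚ - s * u) ≡ 1ℚ * a + (- u) * (a * s)
  expand a s = solve 3 (λ a s u → a :* (con 1ℚ :- s :* u) := con 1ℚ :* a :+ (:- u) :* (a :* s))
                 refl a s u
  factor-out : ∀ x → x * u * ½ ≡ u * ½ * x
  factor-out x = solve 2 (λ x u → x :* u :* con ½ := u :* con ½ :* x) refl x u
  ordered : CrossOrdered r w
  ordered i j i≤j = ÷-cross {r j} {r i} {w i} {w j} (w-pos i) (w-pos j) (ratio i j i≤j)
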